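{- Let $U$ be a connected graph containing exactly one cycle, and assume the cycle has an even number of vertices. Assume that exactly one vertex of the cycle has degree $3$ in $U$ and all other vertices of the cycle have degree $2$ in $U$. Let $\Delta$ be the distance squared matrix of $U$. If $U$ has at least one vertex of degree $2$ that does not lie on the cycle, then $i_0(\Delta)\geq 1$.
   Context: For a connected graph, the distance squared matrix $\Delta$ has $(i,j)$ entry $d_{ij}^2$, where $d_{ij}$ is the shortest-path distance between vertices $i$ and $j$. For a real symmetric matrix $M$, $i_0(M)$ denotes the multiplicity of $0$ as an eigenvalue of $M$. -}

module Defs where

open import Data.Bool using (Bool; true; false; T; _∧_; _∨_)
open import Data.Nat as ℕ using (ℕ; zero; suc; _<_; _≤_; s≤s)
open import Data.Nat.Divisibility using (_∣_)
open import Data.Fin using (Fin; zero; suc; toℕ; fromℕ<; _≟_)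
open import Data.List using (List; []; _∷_; length; filter; foldr; map)
open import Data.Bool.ListAction using (any)
open import Data.List.Base using (allFin)
open import Data.Product using (Σ; ∃; _×_; _,_)
open import Data.Sum using (_⊎_)
open import Data.Integer using (+_)
open import Data.Rational using (ℚ; _/_; _+_; _*_; 0ℚ)
open import Relation.Binary.PropositionalEquality using (_≡_; _≢_)
open import Relation.Nullary using (¬_; yes; no)
open import Relation.Nullary.Decidable using (⌊_⌋)
open import Function.Bundles using (_⇔_)

record SimpleGraph (n : ℕ) : Set where
  field
    adj   : Fin n → Fin n → Bool
    sym   : ∀ u v → adj u v ≡ adj v u
    irrefl : ∀ u → adj u u ≡ false
open SimpleGraph public

Adj : ∀ {n} → SimpleGraph n → Fin n → Fin n → Set
Adj G u v = T (adj G u v)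

data Walk {n} (G : SimpleGraph n) : Fin n → Fin n → ℕ → Set where
  here : ∀ {u} → Walk G u u 0
  step : ∀ {u v w k} → Adj G u v → Walk G v w k → Walk G u w (suc k)

Connected : ∀ {n} → SimpleGraph n → Set
Connected G = ∀ u v → ∃ λ k → Walk G u v k

degree : ∀ {n} → SimpleGraph n → Fin n → ℕ
degree {n} G v = length (filter (λ w → Data.Bool._≟_ (adj G v w) true) (allFin n))

reach : ∀ {n} → SimpleGraph n → ℕ → Fin n → Fin n → Bool
reach G zero u v = ⌊ u ≟ v ⌋
reach {n} G (suc k) u v = reach G k u v ∨ any (λ w → reach G k u w ∧ adj G w v) (allFin n)

-- least k ≤ bound with reach k u v (falls back to the bound if none);
-- for a connected graph with n vertices and bound = n this is the
-- shortest-path distance.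
searchFrom : ∀ {n} → SimpleGraph n → (start fuel : ℕ) → Fin n → Fin n → ℕ
searchFrom G s zero u v = s
searchFrom G s (suc f) u v with reach G s u v
... | true  = s
... | false = searchFrom G (suc s) f u v

dist : ∀ {n} → SimpleGraph n → Fin n → Fin n → ℕ
dist {n} G u v = searchFrom G 0 n u v

DistSq : ∀ {n} → SimpleGraph n → Fin n → Fin n → ℚ
DistSq G i j = (+ (dist G i j ℕ.* dist G i j)) / 1

Σℚ : ∀ n → (Fin n → ℚ) → ℚ
Σℚ n f = foldr _+_ 0ℚ (map f (allFin n))

mulVec : ∀ {n} → (Fin n → Fin n → ℚ) → (Fin n → ℚ) → Fin n → ℚ
mulVec {n} M x i = Σℚ n (λ j → M i j * x j)

-- 0 is an eigenvalue of M, i.e. i₀(M) ≥ 1: some nonzero vector in the kernel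
ZeroIsEigenvalue : ∀ {n} → (Fin n → Fin n → ℚ) → Set
ZeroIsEigenvalue {n} M = Σ (Fin n → ℚ) λ x → (∃ λ i → x i ≢ 0ℚ) × (∀ i → mulVec M x i ≡ 0ℚ)

nextF : ∀ {k} → Fin (suc k) → Fin (suc k)
nextF {k} i with toℕ i ℕ.<? k
... | yes p = fromℕ< (s≤s p)
... | no _  = zero

record IsCycle {n} (G : SimpleGraph n) {k : ℕ} (c : Fin (suc k) → Fin n) : Set where
  field
    long     : 2 ≤ k
    distinct : ∀ i j → c i ≡ c j → i ≡ j
    edges    : ∀ i → Adj G (c i) (c (nextF i))

CycEdge : ∀ {n k} → (Fin (suc k) → Fin n) → Fin n → Fin n → Set
CycEdge c u v = ∃ λ i → (c i ≡ u × c (nextF i) ≡ v) ⊎ (c i ≡ v × c (nextF i) ≡ u)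

-- c is the unique cycle of G (cycles compared as subgraphs, i.e. by edge sets)
UniqueCycle : ∀ {n} (G : SimpleGraph n) {k : ℕ} (c : Fin (suc k) → Fin n) → Set
UniqueCycle {n} G {k} c =
  IsCycle G c ×
  (∀ k' (c' : Fin (suc k') → Fin n) → IsCycle G c' → ∀ u v → CycEdge c u v ⇔ CycEdge c' u v)

OnCycle : ∀ {n k} → (Fin (suc k) → Fin n) → Fin n → Set
OnCycle c v = ∃ λ i → c i ≡ v

-- Let the cycle have 2m vertices, let c₀ be its vertex of degree 3, cₘ the vertex opposite to c₀ and t the neighbour
-- of c₀ off the cycle, and let u, w be the neighbours of the degree-2 vertex v off the cycle. Then
--   x = m(m+1) (e_u + e_w) + 2(m+1) e_c₀ - 2m(m+1) e_v - 2 e_cₘ - 2m e_t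
-- is a kernel vector of Δ with x_v ≠ 0. The edges vu, vw and c₀t lie on no cycle, so each is a bridge: every vertex z
-- lies on one of its two sides, and a shortest path from z to the other side crosses it. Writing D y = d(z,y)², this
-- gives for every z
--   D u + D w = 2 + 2 D v   and   (m+1) D c₀ + m(m+1) = D cₘ + m D t,
-- the second because on the cycle d(z,c₀) + d(z,cₘ) = m and d(z,t) = d(z,c₀) + 1, while off the cycle
-- d(z,c₀) = d(z,t) + 1 and d(z,cₘ) = d(z,t) + 1 + m. The combination of the two identities is (Δx)_z = 0.
module Submission where

open import Defs hiding (sym)
open import Data.Bool as Bool using (Bool; true; false; T; if_then_else_)
open import Data.Bool.Properties using (T-∧; T-∨)
open import Data.Empty using (⊥; ⊥-elim)
open import Data.Fin as Fin using (Fin; zero; suc; toℕ; fromℕ; fromℕ<; inject₁; _≟_)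
open import Data.Fin.Properties
  using (any?; toℕ-injective; toℕ<n; toℕ≤pred[n]; toℕ-fromℕ; toℕ-fromℕ<; toℕ-inject₁; injective⇒≤)
open import Data.Fin.Relation.Unary.Top using (view; ‵fromℕ; ‵inject₁)
open import Data.Integer as ℤ using () renaming (+_ to pos)
import Data.Integer.Properties as ℤ
import Data.Integer.Tactic.RingSolver as ℤ-Solver
open import Data.List using (List; []; _∷_; length; filter; tabulate; allFin; foldr)
open import Data.List.Membership.Propositional using (_∈_; _∉_)
open import Data.List.Membership.Propositional.Properties using (∈-allFin)
open import Data.List.Properties using (map-tabulate)
open import Data.List.Relation.Unary.All as All using (All; []; _∷_)
open import Data.List.Relation.Unary.All.Properties using (¬Any⇒All¬)
open import Data.List.Relation.Unary.Any as Any using (here; there; satisfied)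
open import Data.List.Relation.Unary.Any.Properties using (any⁺; any⁻)
open import Data.List.Relation.Unary.Unique.Propositional using (Unique; []; _∷_)
open import Data.Nat as ℕ using (ℕ; zero; suc; _+_; _*_; _∸_; _≤_; _<_; _%_; z≤n; s≤s; ∣_-_∣)
open import Data.Nat.Divisibility using (_∣_; divides)
open import Data.Nat.DivMod using (m<n⇒m%n≡m; n%n≡0; [m+n]%n≡m%n; %-distribˡ-+; m%n%n≡m%n; m%n<n)
open import Data.Nat.Induction using (<-rec)
open import Data.Nat.Properties hiding (_≟_)
open import Algebra.Properties.Semiring.Sum +-*-semiring
  using (sum; sum-cong-≗; sum-replicate-zero; ∑-distrib-+; *-distribˡ-sum)
open import Data.Nat.Tactic.RingSolver using (solve-∀)
open import Data.Product using (Σ; ∃; ∃₂; _×_; _,_; proj₁; proj₂)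
open import Data.Rational as ℚ using (ℚ; 0ℚ; toℚᵘ)
open import Data.Rational.Properties
  using (+-inverseʳ; toℚᵘ-injective; toℚᵘ-cong; toℚᵘ-fromℚᵘ; toℚᵘ-homo-+; toℚᵘ-homo-*)
open import Data.Rational.Solver using (module +-*-Solver)
open import Data.Rational.Unnormalised as ℚᵘ using (ℚᵘ; mkℚᵘ; *≡*; _≃_)
open import Data.Rational.Unnormalised.Properties as ℚᵘ using (≃-trans; ≃-sym)
open import Data.Sum using (_⊎_; inj₁; inj₂; [_,_]′)
open import Function using (_∘_; _∘′_; id; case_of_)
open import Function.Bundles using (Equivalence)
open import Function.Definitions using (Injective)
open import Relation.Binary.Definitions using (Symmetric; DecidableEquality; tri<; tri≈; tri>)
open import Relation.Binary.PropositionalEquality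
open import Relation.Nullary using (¬_; Dec; yes; no; does; contradiction)
open import Relation.Nullary.Decidable using (T?; toWitness; fromWitness; ¬?; _×-dec_; _⊎-dec_)

count : ∀ {n} → (Fin n → Bool) → ℕ
count {zero}  f = 0
count {suc n} f = (if f zero then 1 else 0) + count (f ∘ suc)

length-filter-tabulate : ∀ {m n} (g : Fin n → Fin m) (f : Fin m → Bool) →
  length (filter (λ w → f w Bool.≟ true) (tabulate g)) ≡ count (f ∘ g)
length-filter-tabulate {n = zero}  g f = refl
length-filter-tabulate {n = suc n} g f with f (g zero)
... | true  = cong suc (length-filter-tabulate (g ∘ suc) f)
... | false = length-filter-tabulate (g ∘ suc) f

remove : ∀ {n} → Fin n → (Fin n → Bool) → Fin n → Bool
remove a f w = if does (w ≟ a) then false else f w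

T-remove⁺ : ∀ {n} (f : Fin n → Bool) {a w} → T (f w) → w ≢ a → T (remove a f w)
T-remove⁺ f {a} {w} fw w≢a with w ≟ a
... | yes w≡a = ⊥-elim (w≢a w≡a)
... | no  _   = fw

T-remove⁻ : ∀ {n} (f : Fin n → Bool) {a w} → T (remove a f w) → T (f w) × w ≢ a
T-remove⁻ f {a} {w} t with w ≟ a
... | no w≢a = t , w≢a

count-remove : ∀ {n} (f : Fin n → Bool) a → T (f a) → count f ≡ suc (count (remove a f))
count-remove f zero    fa with f zero
... | true = refl
count-remove f (suc a) fa with f zero
... | true  = cong suc (count-remove (f ∘ suc) a fa)
... | false = count-remove (f ∘ suc) a fa

count≤suc-count-remove : ∀ {n} (f : Fin n → Bool) a → count f ≤ suc (count (remove a f))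
count≤suc-count-remove f zero with f zero
... | true  = ≤-refl
... | false = n≤1+n _
count≤suc-count-remove f (suc a) with f zero
... | true  = s≤s (count≤suc-count-remove (f ∘ suc) a)
... | false = count≤suc-count-remove (f ∘ suc) a

count-none : ∀ {n} (f : Fin n → Bool) → (∀ y → ¬ T (f y)) → count f ≡ 0
count-none {zero}  f none = refl
count-none {suc n} f none with f zero in eq
... | true  = ⊥-elim (none zero (subst T (sym eq) _))
... | false = count-none (f ∘ suc) (none ∘ suc)

length≤count : ∀ {n} (f : Fin n → Bool) {xs} → Unique xs → All (T ∘ f) xs → length xs ≤ count f
length≤count f []              []         = z≤n
length≤count f {x ∷ _} (x∉ ∷ u) (fx ∷ fxs) = subst (_ ≤_) (sym (count-remove f x fx))
  (s≤s (length≤count (remove x f) u (All.zipWith (λ (x≢y , fy) → T-remove⁺ f fy (x≢y ∘ sym)) (x∉ , fxs))))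

count≤length : ∀ {n} (f : Fin n → Bool) xs → (∀ y → T (f y) → y ∈ xs) → count f ≤ length xs
count≤length f []       ⊆xs = ≤-reflexive (count-none f (λ y fy → case ⊆xs y fy of λ ()))
count≤length f (x ∷ xs) ⊆xs =
  ≤-trans (count≤suc-count-remove f x) (s≤s (count≤length (remove x f) xs ⊆xs′))
  where
  ⊆xs′ : ∀ y → T (remove x f y) → y ∈ xs
  ⊆xs′ y t with T-remove⁻ f t
  ... | fy , y≢x with ⊆xs y fy
  ... | here y≡x   = ⊥-elim (y≢x y≡x)
  ... | there y∈xs = y∈xs

infixr 5 _◅_

data Chain {A : Set} (R : A → A → Set) : A → A → ℕ → Set where
  ε   : ∀ {x} → Chain R x x 0
  _◅_ : ∀ {x y z ℓ} → R x y → Chain R y z ℓ → Chain R x z (suc ℓ)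

module _ {A : Set} {R : A → A → Set} where

  infixr 5 _◅◅_
  infixl 5 _▻_

  private variable
    x y z : A
    ℓ ℓ′ : ℕ

  _◅◅_ : Chain R x y ℓ → Chain R y z ℓ′ → Chain R x z (ℓ + ℓ′)
  ε       ◅◅ q = q
  (r ◅ p) ◅◅ q = r ◅ (p ◅◅ q)

  _▻_ : Chain R x y ℓ → R y z → Chain R x z (suc ℓ)
  ε       ▻ r′ = r′ ◅ ε
  (r ◅ p) ▻ r′ = r ◅ (p ▻ r′)

  reverse : Symmetric R → Chain R x y ℓ → Chain R y x ℓ
  reverse sym ε       = ε
  reverse sym (r ◅ p) = reverse sym p ▻ sym r

  unsnoc : Chain R x z (suc ℓ) → ∃ λ y → Chain R x y ℓ × R y z
  unsnoc (r ◅ ε)      = _ , ε , r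
  unsnoc (r ◅ r′ ◅ p) = let y , q , r″ = unsnoc (r′ ◅ p) in y , r ◅ q , r″

  vertex : Chain R x y ℓ → Fin (suc ℓ) → A
  vertex {x = x} ε       _       = x
  vertex {x = x} (r ◅ p) zero    = x
  vertex         (r ◅ p) (suc i) = vertex p i

  vertex-zero : (p : Chain R x y ℓ) → vertex p zero ≡ x
  vertex-zero ε       = refl
  vertex-zero (r ◅ p) = refl

  vertex-last : (p : Chain R x y ℓ) → vertex p (fromℕ ℓ) ≡ y
  vertex-last ε       = refl
  vertex-last (r ◅ p) = vertex-last p

  vertex-step : (p : Chain R x y ℓ) (i : Fin ℓ) → R (vertex p (inject₁ i)) (vertex p (suc i))
  vertex-step (r ◅ p) zero    = subst (R _) (sym (vertex-zero p)) r
  vertex-step (r ◅ p) (suc i) = vertex-step p i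

  take : (p : Chain R x y ℓ) (i : Fin (suc ℓ)) → Chain R x (vertex p i) (toℕ i)
  take ε       zero    = ε
  take (r ◅ p) zero    = ε
  take (r ◅ p) (suc i) = r ◅ take p i

  drop : (p : Chain R x y ℓ) (i : Fin (suc ℓ)) → Chain R (vertex p i) y (ℓ ∸ toℕ i)
  drop ε       zero    = ε
  drop (r ◅ p) zero    = r ◅ p
  drop (r ◅ p) (suc i) = drop p i

  shortcut : (p : Chain R x y ℓ) {i j : Fin (suc ℓ)} → toℕ i < toℕ j → vertex p i ≡ vertex p j →
             ∃ λ ℓ′ → ℓ′ < ℓ × Chain R x y ℓ′
  shortcut {y = y} {ℓ = ℓ} p {i} {j} i<j pᵢ≡pⱼ =
    toℕ i + (ℓ ∸ toℕ j) , shorter , take p i ◅◅ subst (λ v → Chain R v y _) (sym pᵢ≡pⱼ) (drop p j)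
    where
    shorter : toℕ i + (ℓ ∸ toℕ j) < ℓ
    shorter = subst (toℕ i + (ℓ ∸ toℕ j) <_) (m+[n∸m]≡n (toℕ≤pred[n] j)) (+-monoˡ-< (ℓ ∸ toℕ j) i<j)

  IsPath : ∀ {x y ℓ} → Chain R x y ℓ → Set
  IsPath p = Injective _≡_ _≡_ (vertex p)

  module _ (_≟_ : DecidableEquality A) where

    toPath : ∀ {x y ℓ} → Chain R x y ℓ → ∃ λ ℓ′ → ℓ′ ≤ ℓ × Σ (Chain R x y ℓ′) IsPath
    toPath {x} {y} {ℓ} = <-rec Motive go ℓ
      where
      Motive : ℕ → Set
      Motive ℓ = Chain R x y ℓ → ∃ λ ℓ′ → ℓ′ ≤ ℓ × Σ (Chain R x y ℓ′) IsPath

      go : ∀ ℓ → (∀ {ℓ′} → ℓ′ < ℓ → Motive ℓ′) → Motive ℓ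
      go ℓ rec p with any? (λ i → any? (λ j → (toℕ i ℕ.<? toℕ j) ×-dec (vertex p i ≟ vertex p j)))
      ... | yes (i , j , i<j , pᵢ≡pⱼ) =
        let ℓ′ , ℓ′<ℓ , p′ = shortcut p i<j pᵢ≡pⱼ
            ℓ″ , ℓ″≤ℓ′ , path = rec ℓ′<ℓ p′
        in ℓ″ , ≤-trans ℓ″≤ℓ′ (<⇒≤ ℓ′<ℓ) , path
      ... | no noRepeat = ℓ , ≤-refl , p , injective
        where
        injective : IsPath p
        injective {i} {j} pᵢ≡pⱼ with <-cmp (toℕ i) (toℕ j)
        ... | tri< i<j _ _ = ⊥-elim (noRepeat (i , j , i<j , pᵢ≡pⱼ))
        ... | tri≈ _ i≡j _ = toℕ-injective i≡j
        ... | tri> _ _ j<i = ⊥-elim (noRepeat (j , i , j<i , sym pᵢ≡pⱼ))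

path-length< : ∀ {n} {R : Fin n → Fin n → Set} {x y ℓ} (p : Chain R x y ℓ) → IsPath p → ℓ < n
path-length< p = injective⇒≤

dist² : ∀ {n} → SimpleGraph n → Fin n → Fin n → ℕ
dist² G x y = dist G x y * dist G x y

module _ {n} (G : SimpleGraph n) where

  open import Data.List.Membership.DecPropositional (Fin._≟_ {n}) using (_∈?_)

  Adj-sym : ∀ {x y} → Adj G x y → Adj G y x
  Adj-sym {x} {y} = subst T (SimpleGraph.sym G x y)

  Adj-irrefl : ∀ {x} → ¬ Adj G x x
  Adj-irrefl {x} = subst T (SimpleGraph.irrefl G x)

  degree≡count : ∀ x → degree G x ≡ count (adj G x)
  degree≡count x = length-filter-tabulate id (adj G x)

  neighbour∈ : ∀ {x y ys} → degree G x ≤ length ys → Unique ys → All (Adj G x) ys → Adj G x y → y ∈ ys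
  neighbour∈ {x} {y} {ys} deg≤ unique adjs xy with y ∈? ys
  ... | yes y∈ys = y∈ys
  ... | no  y∉ys = contradiction deg≤ (<⇒≱ (subst (length ys <_) (sym (degree≡count x))
                     (length≤count (adj G x) (¬Any⇒All¬ ys y∉ys ∷ unique) (xy ∷ adjs))))

  opaque
    ∃-neighbour∉ : ∀ {x ys} → length ys < degree G x → ∃ λ y → Adj G x y × y ∉ ys
    ∃-neighbour∉ {x} {ys} ys<deg with any? (λ y → T? (adj G x y) ×-dec ¬? (y ∈? ys))
    ... | yes found = found
    ... | no  none  = contradiction (subst (_≤ length ys) (sym (degree≡count x)) (count≤length (adj G x) ys ∈ys))
                                    (<⇒≱ ys<deg)
      where
      ∈ys : ∀ y → T (adj G x y) → y ∈ ys
      ∈ys y xy with y ∈? ys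
      ... | yes y∈ys = y∈ys
      ... | no  y∉ys = ⊥-elim (none (y , xy , y∉ys))

  Walk⇒Chain : ∀ {x y k} → Walk G x y k → Chain (Adj G) x y k
  Walk⇒Chain here       = ε
  Walk⇒Chain (step e w) = e ◅ Walk⇒Chain w

  reach⇒Chain : ∀ k {x y} → T (reach G k x y) → ∃ λ ℓ → ℓ ≤ k × Chain (Adj G) x y ℓ
  reach⇒Chain zero    r with toWitness r
  ... | refl = 0 , z≤n , ε
  reach⇒Chain (suc k) r with Equivalence.to T-∨ r
  ... | inj₁ r′ = let ℓ , ℓ≤k , p = reach⇒Chain k r′ in ℓ , m≤n⇒m≤1+n ℓ≤k , p
  ... | inj₂ r′ =
    let w , xw∧wy   = satisfied (any⁻ _ (allFin n) r′)
        xw , wy     = Equivalence.to T-∧ xw∧wy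
        ℓ , ℓ≤k , p = reach⇒Chain k xw
    in suc ℓ , s≤s ℓ≤k , p ▻ wy

  Chain⇒reach : ∀ {ℓ x y} → Chain (Adj G) x y ℓ → T (reach G ℓ x y)
  Chain⇒reach {zero}  ε = fromWitness refl
  Chain⇒reach {suc ℓ} p =
    let w , q , wy = unsnoc p
    in Equivalence.from T-∨ (inj₂ (any⁺ _ (Any.map (λ { refl → Equivalence.from T-∧ (Chain⇒reach q , wy) })
                                                   (∈-allFin w))))

  searchFrom≤ : ∀ s f {x y} → searchFrom G s f x y ≤ s + f
  searchFrom≤ s zero    = m≤m+n s 0
  searchFrom≤ s (suc f) {x} {y} with reach G s x y
  ... | true  = m≤m+n s (suc f)
  ... | false = subst (searchFrom G (suc s) f x y ≤_) (sym (+-suc s f)) (searchFrom≤ (suc s) f)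

  searchFrom-reach : ∀ s f {x y} → searchFrom G s f x y < s + f → T (reach G (searchFrom G s f x y) x y)
  searchFrom-reach s zero    found = contradiction (+-identityʳ s) (λ eq → <-irrefl (sym eq) found)
  searchFrom-reach s (suc f) {x} {y} found with reach G s x y in eq
  ... | true  = subst T (sym eq) _
  ... | false = searchFrom-reach (suc s) f (subst (searchFrom G (suc s) f x y <_) (+-suc s f) found)

  searchFrom-least : ∀ s f {x y r} → T (reach G r x y) → s ≤ r → searchFrom G s f x y ≤ r
  searchFrom-least s zero    _ s≤r = s≤r
  searchFrom-least s (suc f) {x} {y} rr s≤r with reach G s x y in eq | m≤n⇒m<n∨m≡n s≤r
  ... | true  | _         = s≤r
  ... | false | inj₁ s<r  = searchFrom-least (suc s) f rr s<r
  ... | false | inj₂ refl = ⊥-elim (subst T eq rr)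

  dist≤length : ∀ {x y ℓ} → Chain (Adj G) x y ℓ → dist G x y ≤ ℓ
  dist≤length {ℓ = ℓ} p with ℓ ℕ.<? n
  ... | yes ℓ<n = searchFrom-least 0 n (Chain⇒reach p) z≤n
  ... | no  ℓ≮n = ≤-trans (searchFrom≤ 0 n) (≮⇒≥ ℓ≮n)

  dist-refl : ∀ x → dist G x x ≡ 0
  dist-refl x = n≤0⇒n≡0 (dist≤length (ε {x = x}))

  vertex-avoids : ∀ {x y z ℓ} (p : Chain (Adj G) x y ℓ) → ℓ < dist G x z → ∀ i → vertex p i ≢ z
  vertex-avoids p ℓ<dist i refl = <⇒≱ ℓ<dist (≤-trans (dist≤length (take p i)) (toℕ≤pred[n] i))

  module _ (connected : Connected G) where

    -- A path has fewer than n edges, so the bounded search defining dist finds a walk of length dist.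
    geodesic : ∀ x y → Chain (Adj G) x y (dist G x y)
    geodesic x y =
      let _ , walk              = connected x y
          ℓ , _ , path , isPath = toPath _≟_ (Walk⇒Chain walk)
          dist<n                = ≤-<-trans (dist≤length path) (path-length< path isPath)
          ℓ′ , ℓ′≤dist , p      = reach⇒Chain (dist G x y) (searchFrom-reach 0 n dist<n)
      in subst (Chain (Adj G) x y) (≤-antisym ℓ′≤dist (dist≤length p)) p

    dist-sym : ∀ x y → dist G x y ≡ dist G y x
    dist-sym x y = ≤-antisym (dist≤length (reverse Adj-sym (geodesic y x)))
                             (dist≤length (reverse Adj-sym (geodesic x y)))

    dist-triangle : ∀ x y z → dist G x z ≤ dist G x y + dist G y z
    dist-triangle x y z = dist≤length (geodesic x y ◅◅ geodesic y z)

    1-Lipschitz⇒≤dist : (φ : Fin n → ℕ) → (∀ {x y} → Adj G x y → φ x ≤ suc (φ y)) →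
                        ∀ x y → φ x ≤ dist G x y + φ y
    1-Lipschitz⇒≤dist φ lipschitz x y = along (geodesic x y)
      where
      along : ∀ {x y ℓ} → Chain (Adj G) x y ℓ → φ x ≤ ℓ + φ y
      along ε       = ≤-refl
      along (e ◅ p) = ≤-trans (lipschitz e) (s≤s (along p))

    no-closer-neighbour⇒dist≡0 : ∀ {x y} → (∀ {y′} → Adj G y′ y → dist G x y ≤ dist G x y′) →
                                 dist G x y ≡ 0
    no-closer-neighbour⇒dist≡0 {x} {y} noCloser = go (geodesic x y) refl
      where
      go : ∀ {ℓ} → Chain (Adj G) x y ℓ → ℓ ≡ dist G x y → dist G x y ≡ 0
      go {zero}  _ ℓ≡dist = sym ℓ≡dist
      go {suc ℓ} p ℓ≡dist =
        let _ , q , y′y = unsnoc p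
        in contradiction (noCloser y′y) (<⇒≱ (≤-trans (s≤s (dist≤length q)) (≤-reflexive ℓ≡dist)))

-- Cycles and bridges

toℕ-nextF : ∀ {k} (i : Fin (suc k)) → toℕ (nextF i) ≡ suc (toℕ i) % suc k
toℕ-nextF {k} i with toℕ i ℕ.<? k
... | yes i<k = trans (toℕ-fromℕ< (s≤s i<k)) (sym (m<n⇒m%n≡m (s≤s i<k)))
... | no  i≮k rewrite ≤-antisym (toℕ≤pred[n] i) (≮⇒≥ i≮k) = sym (n%n≡0 (suc k))

nextF-inject₁ : ∀ {k} (i : Fin k) → nextF (inject₁ i) ≡ suc i
nextF-inject₁ {k} i = toℕ-injective (trans (toℕ-nextF (inject₁ i))
  (trans (cong (λ j → suc j % suc k) (toℕ-inject₁ i)) (m<n⇒m%n≡m (s≤s (toℕ<n i)))))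

nextF-fromℕ : ∀ k → nextF (fromℕ k) ≡ zero
nextF-fromℕ k = toℕ-injective (trans (toℕ-nextF (fromℕ k))
  (trans (cong (λ j → suc j % suc k) (toℕ-fromℕ k)) (n%n≡0 (suc k))))

module _ {n} {G : SimpleGraph n} {R : Fin n → Fin n → Set} (R⇒Adj : ∀ {x y} → R x y → Adj G x y) where

  closedPath-isCycle : ∀ {x y ℓ} (p : Chain R x y (suc (suc ℓ))) → IsPath p → Adj G y x → IsCycle G (vertex p)
  closedPath-isCycle {ℓ = ℓ} p isPath yx =
    record { long = s≤s (s≤s z≤n) ; distinct = λ _ _ → isPath ; edges = edges }
    where
    edges : ∀ i → Adj G (vertex p i) (vertex p (nextF i))
    edges i with view i
    ... | ‵fromℕ     = subst₂ (Adj G) (sym (vertex-last p))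
                         (trans (sym (vertex-zero p)) (cong (vertex p) (sym (nextF-fromℕ (suc (suc ℓ)))))) yx
    ... | ‵inject₁ j = subst (λ j′ → Adj G (vertex p (inject₁ j)) (vertex p j′)) (sym (nextF-inject₁ j))
                         (R⇒Adj (vertex-step p j))

closedPath-cycleEdge : ∀ {n} {R : Fin n → Fin n → Set} {x y ℓ} (p : Chain R x y ℓ) → CycEdge (vertex p) y x
closedPath-cycleEdge {ℓ = ℓ} p =
  fromℕ ℓ , inj₁ (vertex-last p , trans (cong (vertex p) (nextF-fromℕ ℓ)) (vertex-zero p))

CycEdge-sym : ∀ {n k} {c : Fin (suc k) → Fin n} {x y} → CycEdge c x y → CycEdge c y x
CycEdge-sym (i , inj₁ e) = i , inj₂ e
CycEdge-sym (i , inj₂ e) = i , inj₁ e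

cycEdge⇒onCycleˡ : ∀ {n k} {c : Fin (suc k) → Fin n} {x y} → CycEdge c x y → OnCycle c x
cycEdge⇒onCycleˡ (i , inj₁ (cᵢ≡x , _))   = i , cᵢ≡x
cycEdge⇒onCycleˡ (i , inj₂ (_ , cᵢ₊₁≡x)) = nextF i , cᵢ₊₁≡x

cycEdge⇒onCycleʳ : ∀ {n k} {c : Fin (suc k) → Fin n} {x y} → CycEdge c x y → OnCycle c y
cycEdge⇒onCycleʳ = cycEdge⇒onCycleˡ ∘ CycEdge-sym

module BridgeOf {n} (G : SimpleGraph n) {a b : Fin n} (ab : Adj G a b) where

  IsEdge : Fin n → Fin n → Set
  IsEdge x y = (x ≡ a × y ≡ b) ⊎ (x ≡ b × y ≡ a)

  isEdge? : ∀ x y → Dec (IsEdge x y)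
  isEdge? x y = ((x ≟ a) ×-dec (y ≟ b)) ⊎-dec ((x ≟ b) ×-dec (y ≟ a))

  Adj⁻ : Fin n → Fin n → Set
  Adj⁻ x y = Adj G x y × ¬ IsEdge x y

  Adj⁻-sym : ∀ {x y} → Adj⁻ x y → Adj⁻ y x
  Adj⁻-sym (xy , ¬edge) = Adj-sym G xy , λ where
    (inj₁ (refl , refl)) → ¬edge (inj₂ (refl , refl))
    (inj₂ (refl , refl)) → ¬edge (inj₁ (refl , refl))

  IsBridge : Set
  IsBridge = ∀ {ℓ} → ¬ Chain Adj⁻ a b ℓ

  offCycle⇒bridge : ∀ {k} {c : Fin (suc k) → Fin n} → UniqueCycle G c → ¬ CycEdge c a b → IsBridge
  offCycle⇒bridge (_ , unique) ¬ab detour with toPath _≟_ detour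
  ... | _ , _ , ε , _                  = Adj-irrefl G ab
  ... | _ , _ , (_ , ¬edge) ◅ ε , _    = ¬edge (inj₁ (refl , refl))
  ... | _ , _ , p@(_ ◅ _ ◅ _) , isPath =
    let cycle = closedPath-isCycle proj₁ p isPath (Adj-sym G ab)
    in ¬ab (CycEdge-sym (Equivalence.from (unique _ (vertex p) cycle b a) (closedPath-cycleEdge p)))

  avoiding : ∀ {x y ℓ} (p : Chain (Adj G) x y ℓ) → (∀ i → vertex p i ≢ a) → Chain Adj⁻ x y ℓ
  avoiding ε       _      = ε
  avoiding (e ◅ p) avoids = (e , ¬edge) ◅ avoiding p (λ i → avoids (suc i))
    where
    ¬edge : ¬ IsEdge _ _
    ¬edge (inj₁ (x≡a , _)) = avoids zero x≡a
    ¬edge (inj₂ (_ , y≡a)) = avoids (suc zero) (trans (vertex-zero p) y≡a)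

  module Sides (bridge : IsBridge) (connected : Connected G) where

    SameSide : Fin n → Fin n → Set
    SameSide x y = ∃ λ ℓ → Chain Adj⁻ x y ℓ

    sides-disjoint : ∀ {x} → SameSide x a → SameSide x b → ⊥
    sides-disjoint (_ , xa) (_ , xb) = bridge (reverse Adj⁻-sym xa ◅◅ xb)

    sameSide-◅ : ∀ {x x′ y} → Adj⁻ x x′ → SameSide x y → SameSide x′ y
    sameSide-◅ e (ℓ , p) = suc ℓ , Adj⁻-sym e ◅ p

    opaque
      sameSide-cover : ∀ x → SameSide x a ⊎ SameSide x b
      sameSide-cover x = along (geodesic G connected x a)
        where
        along : ∀ {x ℓ} → Chain (Adj G) x a ℓ → SameSide x a ⊎ SameSide x b
        along ε = inj₁ (0 , ε)
        along {x} (_◅_ {y = x′} e p) with isEdge? x x′ | along p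
        ... | yes (inj₁ (refl , _)) | _      = inj₁ (0 , ε)
        ... | yes (inj₂ (refl , _)) | _      = inj₂ (0 , ε)
        ... | no ¬edge              | inj₁ s = inj₁ (sameSide-◅ (Adj⁻-sym (e , ¬edge)) s)
        ... | no ¬edge              | inj₂ s = inj₂ (sameSide-◅ (Adj⁻-sym (e , ¬edge)) s)

    crossing : ∀ {x y ℓ} → SameSide x a → SameSide y b → Chain (Adj G) x y ℓ →
               ∃₂ λ ℓ₁ ℓ₂ → Chain (Adj G) x a ℓ₁ × Chain (Adj G) b y ℓ₂ × suc (ℓ₁ + ℓ₂) ≤ ℓ
    crossing xa yb ε = ⊥-elim (sides-disjoint xa yb)
    crossing {x} xa yb (_◅_ {y = x′} e p) with isEdge? x x′
    ... | yes (inj₁ (refl , refl)) = 0 , _ , ε , p , ≤-refl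
    ... | yes (inj₂ (refl , refl)) = ⊥-elim (sides-disjoint xa (0 , ε))
    ... | no ¬edge =
      let ℓ₁ , ℓ₂ , p₁ , p₂ , ℓ₁+ℓ₂<ℓ = crossing (sameSide-◅ (e , ¬edge) xa) yb p
      in suc ℓ₁ , ℓ₂ , e ◅ p₁ , p₂ , s≤s ℓ₁+ℓ₂<ℓ

    dist-across : ∀ {x y} → SameSide x a → SameSide y b → dist G x y ≡ suc (dist G x a + dist G b y)
    dist-across {x} {y} xa yb = ≤-antisym
      (subst (dist G x y ≤_) (+-suc _ _)
        (dist≤length G (geodesic G connected x a ◅◅ ab ◅ geodesic G connected b y)))
      (let _ , _ , p₁ , p₂ , ℓ₁+ℓ₂<dist = crossing xa yb (geodesic G connected x y)
       in ≤-trans (s≤s (+-mono-≤ (dist≤length G p₁) (dist≤length G p₂))) ℓ₁+ℓ₂<dist)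

    dist-across′ : ∀ {x y} → SameSide x b → SameSide y a → dist G x y ≡ suc (dist G x b + dist G a y)
    dist-across′ {x} {y} xb ya = begin
      dist G x y                    ≡⟨ dist-sym G connected x y ⟩
      dist G y x                    ≡⟨ dist-across ya xb ⟩
      suc (dist G y a + dist G b x) ≡⟨ cong suc (+-comm (dist G y a) (dist G b x)) ⟩
      suc (dist G b x + dist G y a) ≡⟨ cong₂ (λ p q → suc (p + q)) (dist-sym G connected b x)
                                                                   (dist-sym G connected y a) ⟩
      suc (dist G x b + dist G a y) ∎
      where open ≡-Reasoning

    dist-to-b : ∀ {x} → SameSide x a → dist G x b ≡ suc (dist G x a)
    dist-to-b {x} xa =
      trans (dist-across xa (0 , ε)) (cong suc (trans (cong (dist G x a +_) (dist-refl G b)) (+-identityʳ _)))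

    dist-to-a : ∀ {x} → SameSide x b → dist G x a ≡ suc (dist G x b)
    dist-to-a {x} xb =
      trans (dist-across′ xb (0 , ε)) (cong suc (trans (cong (dist G x b +_) (dist-refl G a)) (+-identityʳ _)))

module _ {K : ℕ} .{{_ : ℕ.NonZero K}} where

  [a+b%K]%K≡[a+b]%K : ∀ a b → (a + b % K) % K ≡ (a + b) % K
  [a+b%K]%K≡[a+b]%K a b = begin
    (a + b % K) % K           ≡⟨ %-distribˡ-+ a (b % K) K ⟩
    (a % K + b % K % K) % K   ≡⟨ cong (λ x → (a % K + x) % K) (m%n%n≡m%n b K) ⟩
    (a % K + b % K) % K       ≡⟨ %-distribˡ-+ a b K ⟨
    (a + b) % K               ∎
    where open ≡-Reasoning

  [a%K+b]%K≡[a+b]%K : ∀ a b → (a % K + b) % K ≡ (a + b) % K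
  [a%K+b]%K≡[a+b]%K a b =
    trans (cong (_% K) (+-comm (a % K) b)) (trans ([a+b%K]%K≡[a+b]%K b a) (cong (_% K) (+-comm b a)))

  [a+r+[K∸a]]%K≡r : ∀ {a} r → a ≤ K → r < K → (a + r + (K ∸ a)) % K ≡ r
  [a+r+[K∸a]]%K≡r {a} r a≤K r<K = begin
    (a + r + (K ∸ a)) % K         ≡⟨ cong (λ x → (x + (K ∸ a)) % K) (+-comm a r) ⟩
    (r + a + (K ∸ a)) % K         ≡⟨ cong (_% K) (+-assoc r a (K ∸ a)) ⟩
    (r + (a + (K ∸ a))) % K       ≡⟨ cong (λ x → (r + x) % K) (m+[n∸m]≡n a≤K) ⟩
    (r + K) % K                   ≡⟨ [m+n]%n≡m%n r K ⟩
    r % K                         ≡⟨ m<n⇒m%n≡m r<K ⟩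
    r                             ∎
    where open ≡-Reasoning

  [[a+r]%K+[K∸a]]%K≡r : ∀ {a} r → a ≤ K → r < K → ((a + r) % K + (K ∸ a)) % K ≡ r
  [[a+r]%K+[K∸a]]%K≡r {a} r a≤K r<K = trans ([a%K+b]%K≡[a+b]%K (a + r) (K ∸ a)) ([a+r+[K∸a]]%K≡r r a≤K r<K)

  [a+[j+[K∸a]]%K]%K≡j : ∀ {a} j → a ≤ K → j < K → (a + (j + (K ∸ a)) % K) % K ≡ j
  [a+[j+[K∸a]]%K]%K≡j {a} j a≤K j<K = begin
    (a + (j + (K ∸ a)) % K) % K   ≡⟨ [a+b%K]%K≡[a+b]%K a (j + (K ∸ a)) ⟩
    (a + (j + (K ∸ a))) % K       ≡⟨ cong (_% K) (+-assoc a j (K ∸ a)) ⟨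
    (a + j + (K ∸ a)) % K         ≡⟨ [a+r+[K∸a]]%K≡r j a≤K j<K ⟩
    j                             ∎
    where open ≡-Reasoning

module Rotation {k} (i₀ : Fin (suc k)) where

  rotate : ℕ → Fin (suc k)
  rotate zero    = i₀
  rotate (suc r) = nextF (rotate r)

  toℕ-rotate : ∀ r → toℕ (rotate r) ≡ (toℕ i₀ + r) % suc k
  toℕ-rotate zero    = trans (sym (m<n⇒m%n≡m (toℕ<n i₀))) (cong (_% suc k) (sym (+-identityʳ (toℕ i₀))))
  toℕ-rotate (suc r) = begin
    toℕ (nextF (rotate r))             ≡⟨ toℕ-nextF (rotate r) ⟩
    suc (toℕ (rotate r)) % suc k       ≡⟨ cong (λ x → suc x % suc k) (toℕ-rotate r) ⟩
    (1 + (toℕ i₀ + r) % suc k) % suc k ≡⟨ [a+b%K]%K≡[a+b]%K {suc k} 1 (toℕ i₀ + r) ⟩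
    suc (toℕ i₀ + r) % suc k           ≡⟨ cong (_% suc k) (+-suc (toℕ i₀) r) ⟨
    (toℕ i₀ + suc r) % suc k           ∎
    where open ≡-Reasoning

  rotate-injective : ∀ {r s} → r < suc k → s < suc k → rotate r ≡ rotate s → r ≡ s
  rotate-injective {r} {s} r<K s<K eq = begin
    r                                                 ≡⟨ [[a+r]%K+[K∸a]]%K≡r r i₀≤K r<K ⟨
    ((toℕ i₀ + r) % suc k + (suc k ∸ toℕ i₀)) % suc k ≡⟨ cong (λ x → (x + (suc k ∸ toℕ i₀)) % suc k) same ⟩
    ((toℕ i₀ + s) % suc k + (suc k ∸ toℕ i₀)) % suc k ≡⟨ [[a+r]%K+[K∸a]]%K≡r s i₀≤K s<K ⟩
    s                                                 ∎
    where
    open ≡-Reasoning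
    i₀≤K = <⇒≤ (toℕ<n i₀)
    same = trans (sym (toℕ-rotate r)) (trans (cong toℕ eq) (toℕ-rotate s))

  rotate-period : rotate (suc k) ≡ i₀
  rotate-period = toℕ-injective
    (trans (toℕ-rotate (suc k)) (trans ([m+n]%n≡m%n (toℕ i₀) (suc k)) (m<n⇒m%n≡m (toℕ<n i₀))))

  rotate-surjective : ∀ j → ∃ λ r → r < suc k × rotate r ≡ j
  rotate-surjective j = r , m%n<n (toℕ j + (suc k ∸ toℕ i₀)) (suc k) ,
    toℕ-injective (trans (toℕ-rotate r) ([a+[j+[K∸a]]%K]%K≡j (toℕ j) (<⇒≤ (toℕ<n i₀)) (toℕ<n j)))
    where r = (toℕ j + (suc k ∸ toℕ i₀)) % suc k

-- The cycle and its vertex of degree 3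

∣-∣-step : ∀ x y z → ∣ x - y ∣ ≡ 1 → ∣ x - z ∣ ≤ suc ∣ y - z ∣
∣-∣-step x y z eq = subst (λ e → ∣ x - z ∣ ≤ e + ∣ y - z ∣) eq (∣-∣-triangle x y z)

∣n-suc-n∣≡1 : ∀ n → ∣ n - suc n ∣ ≡ 1
∣n-suc-n∣≡1 zero    = refl
∣n-suc-n∣≡1 (suc n) = ∣n-suc-n∣≡1 n

∣suc-n-n∣≡1 : ∀ n → ∣ suc n - n ∣ ≡ 1
∣suc-n-n∣≡1 n = trans (∣-∣-comm (suc n) n) (∣n-suc-n∣≡1 n)

suc≡m*2⇒0<m : ∀ {k m} → suc k ≡ m * 2 → 0 < m
suc≡m*2⇒0<m {m = suc _} _ = s≤s z≤n

onCycle-identity : ∀ {a b t m} → a + b ≡ m → t ≡ suc a →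
                   (1 + m) * (a * a) + m * (m + 1) ≡ b * b + m * (t * t)
onCycle-identity {a} {b} refl refl = identity a b
  where
  identity : ∀ a b → (1 + (a + b)) * (a * a) + (a + b) * (a + b + 1) ≡ b * b + (a + b) * (suc a * suc a)
  identity = solve-∀

offCycle-identity : ∀ {a b h m} → a ≡ suc h → b ≡ suc (h + m) →
                    (1 + m) * (a * a) + m * (m + 1) ≡ b * b + m * (h * h)
offCycle-identity {h = h} {m} refl refl = identity h m
  where
  identity : ∀ h m → (1 + m) * (suc h * suc h) + m * (m + 1) ≡ suc (h + m) * suc (h + m) + m * (h * h)
  identity = solve-∀

module CycleGeometry {n} (G : SimpleGraph n) (connected : Connected G)
  {k} {c : Fin (suc k) → Fin n} (unicycle : UniqueCycle G c)
  {m} (K≡m*2 : suc k ≡ m * 2) {i₀ : Fin (suc k)}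
  (deg3 : degree G (c i₀) ≡ 3) (deg2 : ∀ j → j ≢ i₀ → degree G (c j) ≡ 2) where

  open Rotation i₀

  K : ℕ
  K = suc k

  isCycle : IsCycle G c
  isCycle = proj₁ unicycle

  d : ℕ → Fin n
  d r = c (rotate r)

  d-injective : ∀ {r s} → r < K → s < K → d r ≡ d s → r ≡ s
  d-injective r<K s<K = rotate-injective r<K s<K ∘ IsCycle.distinct isCycle _ _

  d-period : d K ≡ d 0
  d-period = cong c rotate-period

  d-edge : ∀ r → Adj G (d r) (d (suc r))
  d-edge r = IsCycle.edges isCycle (rotate r)

  d-onCycle : ∀ r → OnCycle c (d r)
  d-onCycle r = rotate r , refl

  onCycle⇒d : ∀ {z} → OnCycle c z → ∃ λ r → r < K × d r ≡ z
  onCycle⇒d (j , refl) = let r , r<K , eq = rotate-surjective j in r , r<K , cong c eq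

  onCycle? : ∀ z → Dec (OnCycle c z)
  onCycle? z = any? (λ i → c i ≟ z)

  2≤k : 2 ≤ k
  2≤k = IsCycle.long isCycle

  1<K : 1 < K
  1<K = s≤s (≤-trans (s≤s z≤n) 2≤k)

  K≡m+m : K ≡ m + m
  K≡m+m = trans K≡m*2 (trans (*-comm m 2) (cong (m +_) (+-identityʳ m)))

  0<m : 0 < m
  0<m = suc≡m*2⇒0<m K≡m*2

  m<K : m < K
  m<K = subst (m <_) (sym K≡m+m) (subst (_< m + m) (+-identityʳ m) (+-monoʳ-< m 0<m))

  d-suc-suc≢d : ∀ {r} → suc r < K → d (suc (suc r)) ≢ d r
  d-suc-suc≢d {r} r+1<K eq with suc (suc r) ℕ.<? K
  ... | yes r+2<K = contradiction (d-injective r+2<K (≤-trans (n≤1+n _) r+1<K) eq) λ ()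
  ... | no  r+2≮K with ≤-antisym r+1<K (≮⇒≥ r+2≮K)
  ...   | refl with d-injective (s≤s z≤n) (≤-trans (n≤1+n _) r+1<K) (trans (sym d-period) eq)
  ...     | refl = contradiction 2≤k λ { (s≤s ()) }

  d-suc-neighbours : ∀ {r y} → suc r < K → Adj G (d (suc r)) y → y ∈ d (suc (suc r)) ∷ d r ∷ []
  d-suc-neighbours {r} r+1<K = neighbour∈ G (≤-reflexive degree≡2)
    ((d-suc-suc≢d r+1<K ∷ []) ∷ [] ∷ []) (d-edge (suc r) ∷ Adj-sym G (d-edge r) ∷ [])
    where
    degree≡2 : degree G (d (suc r)) ≡ 2
    degree≡2 = deg2 _ (λ eq → contradiction (rotate-injective r+1<K (s≤s z≤n) eq) λ ())

  d0-dk : Adj G (d 0) (d k)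
  d0-dk = Adj-sym G (subst (Adj G (d k)) d-period (d-edge k))

  d1≢dk : d 1 ≢ d k
  d1≢dk eq with d-injective 1<K ≤-refl eq
  ... | refl = contradiction 2≤k λ { (s≤s ()) }

  opaque
    thirdNeighbour : ∃ λ t → Adj G (d 0) t × t ∉ d 1 ∷ d k ∷ []
    thirdNeighbour = ∃-neighbour∉ G (≤-reflexive (sym deg3))

  t : Fin n
  t = proj₁ thirdNeighbour

  d0-t : Adj G (d 0) t
  d0-t = proj₁ (proj₂ thirdNeighbour)

  t∉ : t ∉ d 1 ∷ d k ∷ []
  t∉ = proj₂ (proj₂ thirdNeighbour)

  d0-neighbours : ∀ {y} → Adj G (d 0) y → y ∈ d 1 ∷ d k ∷ t ∷ []
  d0-neighbours = neighbour∈ G (≤-reflexive deg3)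
    ((d1≢dk ∷ (λ eq → t∉ (here (sym eq))) ∷ []) ∷ ((λ eq → t∉ (there (here (sym eq)))) ∷ []) ∷ [] ∷ [])
    (d-edge 0 ∷ d0-dk ∷ d0-t ∷ [])

  t-offCycle : ¬ OnCycle c t
  t-offCycle onCycle with onCycle⇒d onCycle
  ... | zero , _ , d0≡t = Adj-irrefl G (subst (Adj G (d 0)) (sym d0≡t) d0-t)
  ... | suc r , r+1<K , dr+1≡t with d-suc-neighbours r+1<K (Adj-sym G (subst (Adj G (d 0)) (sym dr+1≡t) d0-t))
  ...   | there (here d0≡dr) with d-injective (s≤s z≤n) (≤-trans (n≤1+n _) r+1<K) d0≡dr
  ...     | refl = t∉ (here (sym dr+1≡t))
  t-offCycle onCycle | suc r , r+1<K , dr+1≡t | here d0≡dr+2 with suc (suc r) ℕ.<? K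
  ...   | yes r+2<K = contradiction (d-injective (s≤s z≤n) r+2<K d0≡dr+2) λ ()
  ...   | no  r+2≮K with ≤-antisym r+1<K (≮⇒≥ r+2≮K)
  ...     | refl = t∉ (there (here (sym dr+1≡t)))

  offCycle-neighbour : ∀ {r y} → r < K → Adj G (d r) y → ¬ OnCycle c y → r ≡ 0
  offCycle-neighbour {zero}  _     _  _        = refl
  offCycle-neighbour {suc r} r+1<K dy offCycle with d-suc-neighbours r+1<K dy
  ... | here  refl        = contradiction (d-onCycle (suc (suc r))) offCycle
  ... | there (here refl) = contradiction (d-onCycle r) offCycle

  opaque
    position? : ∀ z → Dec (∃ λ (r : Fin K) → d (toℕ r) ≡ z)
    position? z = any? (λ r → d (toℕ r) ≟ z)

    -- φ (d r) = ∣ r - m ∣ on the cycle and φ = m off it: a 1-Lipschitz potential with φ (d 0) = m and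
    -- φ (d m) = 0, hence the lower bound m for dist (d 0) (d m).
    φ : Fin n → ℕ
    φ z with position? z
    ... | yes (r , _) = ∣ toℕ r - m ∣
    ... | no  _       = m

    φ-d : ∀ {r} → r < K → φ (d r) ≡ ∣ r - m ∣
    φ-d {r} r<K with position? (d r)
    ... | yes (r′ , eq) = cong (λ x → ∣ x - m ∣) (d-injective (toℕ<n r′) r<K eq)
    ... | no  none      = contradiction (fromℕ< r<K , cong d (toℕ-fromℕ< r<K)) none

    φ-offCycle : ∀ {z} → ¬ OnCycle c z → φ z ≡ m
    φ-offCycle {z} offCycle with position? z
    ... | yes (r , eq) = contradiction (subst (OnCycle c) eq (d-onCycle (toℕ r))) offCycle
    ... | no  _        = refl

  ∣K-m∣≡m : ∣ K - m ∣ ≡ m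
  ∣K-m∣≡m = trans (cong (λ x → ∣ x - m ∣) K≡m+m) (trans (∣-∣-comm (m + m) m) (∣m-m+n∣≡n m m))

  φ-d≤K : ∀ {r} → r ≤ K → φ (d r) ≡ ∣ r - m ∣
  φ-d≤K {r} r≤K with m≤n⇒m<n∨m≡n r≤K
  ... | inj₁ r<K  = φ-d r<K
  ... | inj₂ refl = trans (cong φ d-period) (trans (φ-d (s≤s z≤n)) (sym ∣K-m∣≡m))

  φ-step : ∀ {x y p q} → φ x ≡ p → φ y ≡ q → p ≤ suc q → φ x ≤ suc (φ y)
  φ-step refl refl p≤1+q = p≤1+q

  φ-onCycle-Lipschitz : ∀ {r y} → r < K → Adj G (d r) y → φ (d r) ≤ suc (φ y)
  φ-onCycle-Lipschitz {zero} _ dy with d0-neighbours dy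
  ... | here refl                 = φ-step (φ-d (s≤s z≤n)) (φ-d 1<K) (∣-∣-step 0 1 m refl)
  ... | there (here refl)         = φ-step (trans (cong φ (sym d-period)) (φ-d≤K ≤-refl)) (φ-d ≤-refl)
                                           (∣-∣-step K k m (∣suc-n-n∣≡1 k))
  ... | there (there (here refl)) = φ-step (φ-d (s≤s z≤n)) (φ-offCycle t-offCycle) (n≤1+n m)
  φ-onCycle-Lipschitz {suc r} r+1<K dy with d-suc-neighbours r+1<K dy
  ... | here refl         = φ-step (φ-d r+1<K) (φ-d≤K r+1<K)
                                   (∣-∣-step (suc r) (suc (suc r)) m (∣n-suc-n∣≡1 (suc r)))
  ... | there (here refl) = φ-step (φ-d r+1<K) (φ-d (≤-trans (n≤1+n _) r+1<K))
                                   (∣-∣-step (suc r) r m (∣suc-n-n∣≡1 r))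

  φ-Lipschitz : ∀ {x y} → Adj G x y → φ x ≤ suc (φ y)
  φ-Lipschitz {x} {y} xy with onCycle? x | onCycle? y
  ... | yes onCycle | _ =
    let r , r<K , dr≡x = onCycle⇒d onCycle
    in subst (λ x → φ x ≤ suc (φ y)) dr≡x (φ-onCycle-Lipschitz r<K (subst (λ x → Adj G x y) (sym dr≡x) xy))
  ... | no offCycle | no offCycleʸ = φ-step (φ-offCycle offCycle) (φ-offCycle offCycleʸ) (n≤1+n m)
  ... | no offCycle | yes onCycle with onCycle⇒d onCycle
  ...   | s , s<K , ds≡y with offCycle-neighbour s<K (subst (λ y → Adj G y x) (sym ds≡y) (Adj-sym G xy)) offCycle
  ...     | refl = φ-step (φ-offCycle offCycle) (trans (cong φ (sym ds≡y)) (φ-d (s≤s z≤n))) (n≤1+n m)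

  arc : ∀ {r s} ℓ → r + ℓ ≡ s → Chain (Adj G) (d r) (d s) ℓ
  arc {r} zero    r+0≡s   = subst (λ s → Chain (Adj G) (d r) (d s) 0) (trans (sym (+-identityʳ r)) r+0≡s) ε
  arc {r} (suc ℓ) r+ℓ+1≡s = d-edge r ◅ arc ℓ (trans (sym (+-suc r ℓ)) r+ℓ+1≡s)

  dist-d0-dm : dist G (d 0) (d m) ≡ m
  dist-d0-dm = ≤-antisym (dist≤length G (arc {0} m refl)) (subst₂ _≤_ (φ-d (s≤s z≤n)) dist+0 lower-bound)
    where
    lower-bound : φ (d 0) ≤ dist G (d 0) (d m) + φ (d m)
    lower-bound = 1-Lipschitz⇒≤dist G connected φ φ-Lipschitz (d 0) (d m)
    dist+0 : dist G (d 0) (d m) + φ (d m) ≡ dist G (d 0) (d m)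
    dist+0 = trans (cong (dist G (d 0) (d m) +_) (trans (φ-d m<K) (∣n-n∣≡0 m))) (+-identityʳ _)

  dist-d0+dist-dm : ∀ {r} → r < K → dist G (d r) (d 0) + dist G (d r) (d m) ≡ m
  dist-d0+dist-dm {r} r<K = ≤-antisym upper lower
    where
    lower : m ≤ dist G (d r) (d 0) + dist G (d r) (d m)
    lower = subst₂ (λ p q → p ≤ q + dist G (d r) (d m)) dist-d0-dm (dist-sym G connected (d 0) (d r))
              (dist-triangle G connected (d 0) (d r) (d m))
    upper : dist G (d r) (d 0) + dist G (d r) (d m) ≤ m
    upper with r ℕ.≤? m
    ... | yes r≤m = subst (dist G (d r) (d 0) + dist G (d r) (d m) ≤_) (m+[n∸m]≡n r≤m)
      (+-mono-≤ (dist≤length G (reverse (Adj-sym G) (arc {0} r refl)))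
                (dist≤length G (arc {r} (m ∸ r) (m+[n∸m]≡n r≤m))))
    ... | no  r≰m = subst (dist G (d r) (d 0) + dist G (d r) (d m) ≤_) K-r+r-m≡m
      (+-mono-≤ (dist≤length G (subst (λ z → Chain (Adj G) (d r) z (K ∸ r)) d-period
                                      (arc {r} (K ∸ r) (m+[n∸m]≡n (<⇒≤ r<K)))))
                (dist≤length G (reverse (Adj-sym G) (arc {m} (r ∸ m) (m+[n∸m]≡n m≤r)))))
      where
      m≤r = <⇒≤ (≰⇒> r≰m)
      K-r+r-m≡m : (K ∸ r) + (r ∸ m) ≡ m
      K-r+r-m≡m = +-cancelʳ-≡ _ _ m (begin
        K ∸ r + (r ∸ m) + m   ≡⟨ +-assoc (K ∸ r) (r ∸ m) m ⟩
        K ∸ r + (r ∸ m + m)   ≡⟨ cong (K ∸ r +_) (m∸n+n≡m m≤r) ⟩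
        K ∸ r + r             ≡⟨ m∸n+n≡m (<⇒≤ r<K) ⟩
        K                     ≡⟨ K≡m+m ⟩
        m + m                 ∎)
        where open ≡-Reasoning

  open BridgeOf G d0-t using (Adj⁻; Adj⁻-sym; offCycle⇒bridge)
  open BridgeOf.Sides G d0-t (offCycle⇒bridge unicycle (t-offCycle ∘ cycEdge⇒onCycleʳ)) connected

  onCycle-closed : ∀ {x y ℓ} → Chain Adj⁻ x y ℓ → OnCycle c y → OnCycle c x
  onCycle-closed ε onCycle = onCycle
  onCycle-closed ((xx′ , ¬edge) ◅ p) onCycle with onCycle⇒d (onCycle-closed p onCycle)
  ... | zero , _ , refl with d0-neighbours (Adj-sym G xx′)
  ...   | here refl                = d-onCycle 1
  ...   | there (here refl)        = d-onCycle k
  ...   | there (there (here x≡t)) = contradiction (inj₂ (x≡t , refl)) ¬edge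
  onCycle-closed ((xx′ , _) ◅ p) onCycle | suc r , r+1<K , refl with d-suc-neighbours r+1<K (Adj-sym G xx′)
  ...   | here refl         = d-onCycle (suc (suc r))
  ...   | there (here refl) = d-onCycle r

  onCycle⇒side-d0 : ∀ {z} → OnCycle c z → SameSide z (d 0)
  onCycle⇒side-d0 {z} onCycle =
    [ id , (λ (_ , z⇝t) → contradiction (onCycle-closed (reverse Adj⁻-sym z⇝t) onCycle) t-offCycle) ]′
      (sameSide-cover z)

  offCycle⇒side-t : ∀ {z} → ¬ OnCycle c z → SameSide z t
  offCycle⇒side-t {z} offCycle =
    [ (λ (_ , z⇝d0) → contradiction (onCycle-closed z⇝d0 (d-onCycle 0)) offCycle) , id ]′
      (sameSide-cover z)

  dist²-identity : ∀ z → (1 + m) * dist² G z (d 0) + m * (m + 1) ≡ dist² G z (d m) + m * dist² G z t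
  dist²-identity z with onCycle? z
  ... | yes onCycle =
    let r , r<K , dr≡z = onCycle⇒d onCycle
    in onCycle-identity (subst (λ z → dist G z (d 0) + dist G z (d m) ≡ m) dr≡z (dist-d0+dist-dm r<K))
                        (dist-to-b (onCycle⇒side-d0 onCycle))
  ... | no offCycle =
    offCycle-identity (dist-to-a (offCycle⇒side-t offCycle))
      (trans (dist-across′ (offCycle⇒side-t offCycle) (onCycle⇒side-d0 (d-onCycle m)))
             (cong (λ x → suc (dist G z t + x)) dist-d0-dm))

-- A vertex of degree 2 off the cycle

module TwoBridges {n} (G : SimpleGraph n) (connected : Connected G) {v u w : Fin n}
  (vu : Adj G v u) (vw : Adj G v w) (u≢w : u ≢ w) (neighbours : ∀ {y} → Adj G v y → y ∈ u ∷ w ∷ [])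
  (bridge-vu : BridgeOf.IsBridge G vu) (bridge-vw : BridgeOf.IsBridge G vw) where

  module U = BridgeOf G vu
  module W = BridgeOf G vw
  open U.Sides bridge-vu connected using ()
    renaming (SameSide to SameSideᵘ; sameSide-cover to coverᵘ; dist-to-b to dist-to-u; dist-to-a to dist-to-vᵘ)
  open W.Sides bridge-vw connected using ()
    renaming (SameSide to SameSideʷ; sameSide-cover to coverʷ; dist-to-b to dist-to-w; dist-to-a to dist-to-vʷ)

  dist-to-v≡0 : ∀ {z} → dist G z u ≡ suc (dist G z v) → dist G z w ≡ suc (dist G z v) → dist G z v ≡ 0
  dist-to-v≡0 {z} zu zw = no-closer-neighbour⇒dist≡0 G connected λ y′v →
    case neighbours (Adj-sym G y′v) of λ where
      (here refl)         → ≤-trans (n≤1+n _) (≤-reflexive (sym zu))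
      (there (here refl)) → ≤-trans (n≤1+n _) (≤-reflexive (sym zw))

  wv : U.Adj⁻ w v
  wv = Adj-sym G vw , λ where
    (inj₁ (w≡v , _)) → Adj-irrefl G (subst (Adj G v) w≡v vw)
    (inj₂ (w≡u , _)) → u≢w (sym w≡u)

  dist²-identity : ∀ z → dist² G z u + dist² G z w ≡ 2 + 2 * dist² G z v
  dist²-identity z = bySides (coverᵘ z) (coverʷ z)
    where
    at-v : ∀ {a b c} → a ≡ suc c → b ≡ suc c → c ≡ 0 → a * a + b * b ≡ 2 + 2 * (c * c)
    at-v refl refl refl = refl

    beside-v : ∀ {a b c} → a ≡ suc c → c ≡ suc b → a * a + b * b ≡ 2 + 2 * (c * c)
    beside-v {b = b} refl refl = identity b
      where
      identity : ∀ b → suc (suc b) * suc (suc b) + b * b ≡ 2 + 2 * (suc b * suc b)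
      identity = solve-∀

    avoid-v : ∀ {y} → dist G z v ≡ suc (dist G z y) → Chain U.Adj⁻ z y (dist G z y)
    avoid-v {y} zv = U.avoiding (geodesic G connected z y)
                                (vertex-avoids G (geodesic G connected z y) (≤-reflexive (sym zv)))

    bySides : SameSideᵘ z v ⊎ SameSideᵘ z u → SameSideʷ z v ⊎ SameSideʷ z w →
              dist² G z u + dist² G z w ≡ 2 + 2 * dist² G z v
    bySides (inj₁ zvᵘ) (inj₁ zvʷ) =
      at-v (dist-to-u zvᵘ) (dist-to-w zvʷ) (dist-to-v≡0 (dist-to-u zvᵘ) (dist-to-w zvʷ))
    bySides (inj₁ zvᵘ) (inj₂ zw)  = beside-v (dist-to-u zvᵘ) (dist-to-vʷ zw)
    bySides (inj₂ zu)  (inj₁ zvʷ) = trans (+-comm (dist² G z u) _) (beside-v (dist-to-w zvʷ) (dist-to-vᵘ zu))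
    -- shortest paths from z to u and to w avoid v, so with the edge wv they bypass the bridge vu
    bySides (inj₂ zu)  (inj₂ zw)  = ⊥-elim (bridge-vu (reverse U.Adj⁻-sym u⇝v))
      where
      u⇝v : Chain U.Adj⁻ u v _
      u⇝v = reverse U.Adj⁻-sym (avoid-v (dist-to-vᵘ zu)) ◅◅ (avoid-v (dist-to-vʷ zw) ▻ wv)

offCycle-degree2 : ∀ {n} {G : SimpleGraph n} {k} {c : Fin (suc k) → Fin n} {v} →
  Connected G → UniqueCycle G c → degree G v ≡ 2 → ¬ OnCycle c v →
  ∃₂ λ u w → Adj G v u × Adj G v w × (∀ z → dist² G z u + dist² G z w ≡ 2 + 2 * dist² G z v)
offCycle-degree2 {G = G} {v = v} connected unicycle deg≡2 offCycle =
  let u , vu , _   = ∃-neighbour∉ G {ys = []} (subst (0 <_) (sym deg≡2) (s≤s z≤n))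
      w , vw , w∉u = ∃-neighbour∉ G {ys = u ∷ []} (subst (1 <_) (sym deg≡2) ≤-refl)
      u≢w          = λ u≡w → w∉u (here (sym u≡w))
      neighbours   = λ {y} → neighbour∈ G {y = y} (≤-reflexive deg≡2) ((u≢w ∷ []) ∷ [] ∷ []) (vu ∷ vw ∷ [])
  in u , w , vu , vw , TwoBridges.dist²-identity G connected vu vw u≢w neighbours (bridge vu) (bridge vw)
  where
  bridge : ∀ {y} (vy : Adj G v y) → BridgeOf.IsBridge G vy
  bridge vy = BridgeOf.offCycle⇒bridge G vy unicycle (offCycle ∘ cycEdge⇒onCycleˡ)

pointMass : ∀ {n} → Fin n → Fin n → ℕ
pointMass p j = if does (p ≟ j) then 1 else 0

pointMass-≢ : ∀ {n} {p j : Fin n} → p ≢ j → pointMass p j ≡ 0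
pointMass-≢ {p = p} {j} p≢j with p ≟ j
... | yes p≡j = ⊥-elim (p≢j p≡j)
... | no  _   = refl

pointMass-refl : ∀ {n} (p : Fin n) → pointMass p p ≡ 1
pointMass-refl p with p ≟ p
... | yes _   = refl
... | no  p≢p = ⊥-elim (p≢p refl)

sum-pointMass : ∀ {n} (D : Fin n → ℕ) p → sum (λ j → D j * pointMass p j) ≡ D p
sum-pointMass {suc n} D zero = begin
  D zero * 1 + sum (λ j → D (suc j) * 0) ≡⟨ cong₂ _+_ (*-identityʳ (D zero))
                                                     (sum-cong-≗ {n} (λ j → *-zeroʳ (D (suc j)))) ⟩
  D zero + sum {n} (λ _ → 0)             ≡⟨ cong (D zero +_) (sum-replicate-zero n) ⟩
  D zero + 0                             ≡⟨ +-identityʳ (D zero) ⟩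
  D zero                                 ∎
  where open ≡-Reasoning
sum-pointMass {suc n} D (suc p) =
  trans (cong (_+ sum (λ j → D (suc j) * pointMass p j)) (*-zeroʳ (D zero))) (sum-pointMass (D ∘′ suc) p)

-- weighted ws is the vector Σ a · eₚ over the pairs (a , p) in ws; pairing D ws = Σ a · D p is its pairing with D.
weighted : ∀ {n} → List (ℕ × Fin n) → Fin n → ℕ
weighted []             j = 0
weighted ((a , p) ∷ ws) j = a * pointMass p j + weighted ws j

pairing : ∀ {n} → (Fin n → ℕ) → List (ℕ × Fin n) → ℕ
pairing D []             = 0
pairing D ((a , p) ∷ ws) = a * D p + pairing D ws

sum-weighted : ∀ {n} (D : Fin n → ℕ) ws → sum (λ j → D j * weighted ws j) ≡ pairing D ws
sum-weighted {n} D [] = trans (sum-cong-≗ {n} (λ j → *-zeroʳ (D j))) (sum-replicate-zero n)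
sum-weighted {n} D ((a , p) ∷ ws) = begin
  sum (λ j → D j * (a * pointMass p j + weighted ws j))
    ≡⟨ sum-cong-≗ {n} (λ j → distribute (D j) a (pointMass p j) (weighted ws j)) ⟩
  sum (λ j → a * (D j * pointMass p j) + D j * weighted ws j)
    ≡⟨ ∑-distrib-+ (λ j → a * (D j * pointMass p j)) (λ j → D j * weighted ws j) ⟩
  sum (λ j → a * (D j * pointMass p j)) + sum (λ j → D j * weighted ws j)
    ≡⟨ cong₂ _+_ (sym (*-distribˡ-sum a (λ j → D j * pointMass p j))) (sum-weighted D ws) ⟩
  a * sum (λ j → D j * pointMass p j) + pairing D ws
    ≡⟨ cong (λ s → a * s + pairing D ws) (sum-pointMass D p) ⟩
  a * D p + pairing D ws
    ∎
  where
  open ≡-Reasoning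
  distribute : ∀ d a x y → d * (a * x + y) ≡ a * (d * x) + d * y
  distribute = solve-∀

weighted-∉ : ∀ {n} {j : Fin n} ws → All (λ (_ , p) → p ≢ j) ws → weighted ws j ≡ 0
weighted-∉ []             []            = refl
weighted-∉ ((a , p) ∷ ws) (p≢j ∷ p∉ws) =
  cong₂ _+_ (trans (cong (a *_) (pointMass-≢ p≢j)) (*-zeroʳ a)) (weighted-∉ ws p∉ws)

weighted-head-pos : ∀ {n} {a} {p : Fin n} ws → 0 < a → 0 < weighted ((a , p) ∷ ws) p
weighted-head-pos {a = a} {p} ws 0<a =
  ≤-trans (subst (0 <_) (sym (trans (cong (a *_) (pointMass-refl p)) (*-identityʳ a))) 0<a) (m≤m+n _ _)

-- The embedding ℕ → ℚ and kernel vectors with integer entries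

ι : ℕ → ℚ
ι a = pos a ℚ./ 1

ιᵘ : ℕ → ℚᵘ
ιᵘ a = mkℚᵘ (pos a) 0

toℚᵘ-ι : ∀ a → toℚᵘ (ι a) ≃ ιᵘ a
toℚᵘ-ι a = toℚᵘ-fromℚᵘ (ιᵘ a)

ι-+ : ∀ a b → ι (a + b) ≡ ι a ℚ.+ ι b
ι-+ a b = toℚᵘ-injective (≃-trans (toℚᵘ-ι (a + b)) (≃-trans ιᵘ-+
  (≃-sym (≃-trans (toℚᵘ-homo-+ (ι a) (ι b)) (ℚᵘ.+-cong (toℚᵘ-ι a) (toℚᵘ-ι b))))))
  where
  identity : ∀ x y → (x ℤ.+ y) ℤ.* pos 1 ≡ (x ℤ.* pos 1 ℤ.+ y ℤ.* pos 1) ℤ.* pos 1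
  identity = ℤ-Solver.solve-∀
  ιᵘ-+ : ιᵘ (a + b) ≃ ιᵘ a ℚᵘ.+ ιᵘ b
  ιᵘ-+ = *≡* (trans (cong (ℤ._* pos 1) (ℤ.pos-+ a b)) (identity (pos a) (pos b)))

ι-* : ∀ a b → ι (a * b) ≡ ι a ℚ.* ι b
ι-* a b = toℚᵘ-injective (≃-trans (toℚᵘ-ι (a * b)) (≃-trans ιᵘ-*
  (≃-sym (≃-trans (toℚᵘ-homo-* (ι a) (ι b)) (ℚᵘ.*-cong (toℚᵘ-ι a) (toℚᵘ-ι b))))))
  where
  ιᵘ-* : ιᵘ (a * b) ≃ ιᵘ a ℚᵘ.* ιᵘ b
  ιᵘ-* = *≡* (cong (ℤ._* pos 1) (ℤ.pos-* a b))

ι-injective : ∀ {a b} → ι a ≡ ι b → a ≡ b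
ι-injective {a} {b} eq with ≃-trans (≃-sym (toℚᵘ-ι a)) (≃-trans (toℚᵘ-cong eq) (toℚᵘ-ι b))
... | *≡* a*1≡b*1 = ℤ.+-injective (trans (sym (ℤ.*-identityʳ (pos a))) (trans a*1≡b*1 (ℤ.*-identityʳ (pos b))))

p-q≡0⇒p≡q : ∀ {p q} → p ℚ.- q ≡ 0ℚ → p ≡ q
p-q≡0⇒p≡q {p} {q} eq = begin
  p               ≡⟨ solve 2 (λ p q → p := (p :- q) :+ q) refl p q ⟩
  p ℚ.- q ℚ.+ q   ≡⟨ cong (ℚ._+ q) eq ⟩
  0ℚ ℚ.+ q        ≡⟨ solve 1 (λ q → con 0ℚ :+ q := q) refl q ⟩
  q               ∎
  where
  open ≡-Reasoning
  open +-*-Solver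

Σℚ-suc : ∀ n (f : Fin (suc n) → ℚ) → Σℚ (suc n) f ≡ f zero ℚ.+ Σℚ n (f ∘′ suc)
Σℚ-suc n f = cong (λ xs → f zero ℚ.+ foldr ℚ._+_ 0ℚ xs)
  (trans (map-tabulate suc f) (sym (map-tabulate id (f ∘′ suc))))

Σℚ-ι : ∀ n (h f g : Fin n → ℕ) →
       Σℚ n (λ j → ι (h j) ℚ.* (ι (f j) ℚ.- ι (g j)))
         ≡ ι (sum (λ j → h j * f j)) ℚ.- ι (sum (λ j → h j * g j))
Σℚ-ι zero    h f g = refl
Σℚ-ι (suc n) h f g = begin
  Σℚ (suc n) (λ j → ι (h j) ℚ.* (ι (f j) ℚ.- ι (g j)))
    ≡⟨ Σℚ-suc n (λ j → ι (h j) ℚ.* (ι (f j) ℚ.- ι (g j))) ⟩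
  ι h₀ ℚ.* (ι f₀ ℚ.- ι g₀) ℚ.+ Σℚ n (λ j → ι (h (suc j)) ℚ.* (ι (f (suc j)) ℚ.- ι (g (suc j))))
    ≡⟨ cong (ι h₀ ℚ.* (ι f₀ ℚ.- ι g₀) ℚ.+_) (Σℚ-ι n (h ∘′ suc) (f ∘′ suc) (g ∘′ suc)) ⟩
  ι h₀ ℚ.* (ι f₀ ℚ.- ι g₀) ℚ.+ (ι F ℚ.- ι G)
    ≡⟨ solve 5 (λ x p q A B → x :* (p :- q) :+ (A :- B) := (x :* p :+ A) :- (x :* q :+ B)) refl
               (ι h₀) (ι f₀) (ι g₀) (ι F) (ι G) ⟩
  (ι h₀ ℚ.* ι f₀ ℚ.+ ι F) ℚ.- (ι h₀ ℚ.* ι g₀ ℚ.+ ι G)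
    ≡⟨ cong₂ ℚ._-_ (trans (ι-+ (h₀ * f₀) F) (cong (ℚ._+ ι F) (ι-* h₀ f₀)))
                   (trans (ι-+ (h₀ * g₀) G) (cong (ℚ._+ ι G) (ι-* h₀ g₀))) ⟨
  ι (h₀ * f₀ + F) ℚ.- ι (h₀ * g₀ + G)
    ∎
  where
  open ≡-Reasoning
  open +-*-Solver
  h₀ = h zero
  f₀ = f zero
  g₀ = g zero
  F = sum (λ j → h (suc j) * f (suc j))
  G = sum (λ j → h (suc j) * g (suc j))

mulVec-weighted : ∀ {n} (D : Fin n → Fin n → ℕ) ws⁺ ws⁻ i →
  mulVec (λ i j → ι (D i j)) (λ j → ι (weighted ws⁺ j) ℚ.- ι (weighted ws⁻ j)) i
    ≡ ι (pairing (D i) ws⁺) ℚ.- ι (pairing (D i) ws⁻)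
mulVec-weighted {n} D ws⁺ ws⁻ i = trans (Σℚ-ι n (D i) (weighted ws⁺) (weighted ws⁻))
  (cong₂ (λ a b → ι a ℚ.- ι b) (sum-weighted (D i) ws⁺) (sum-weighted (D i) ws⁻))

weighted-kernel : ∀ {n} (D : Fin n → Fin n → ℕ) ws⁺ ws⁻ →
                  (∀ i → pairing (D i) ws⁺ ≡ pairing (D i) ws⁻) →
                  ∀ {j} → weighted ws⁺ j ≢ weighted ws⁻ j → ZeroIsEigenvalue (λ i j → ι (D i j))
weighted-kernel D ws⁺ ws⁻ balanced {j} ws⁺≢ws⁻ =
  x , (j , ws⁺≢ws⁻ ∘′ ι-injective ∘′ p-q≡0⇒p≡q) , Dx≡0
  where
  x : Fin _ → ℚ
  x l = ι (weighted ws⁺ l) ℚ.- ι (weighted ws⁻ l)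
  Dx≡0 : ∀ i → mulVec (λ i j → ι (D i j)) x i ≡ 0ℚ
  Dx≡0 i = trans (mulVec-weighted D ws⁺ ws⁻ i)
    (trans (cong (λ a → ι a ℚ.- ι (pairing (D i) ws⁻)) (balanced i)) (+-inverseʳ (ι (pairing (D i) ws⁻))))

kernel-identity : ∀ m {du dw dv d₀ dₘ dₜ} →
  du + dw ≡ 2 + 2 * dv → (1 + m) * d₀ + m * (m + 1) ≡ dₘ + m * dₜ →
  m * (m + 1) * du + (m * (m + 1) * dw + (2 * (1 + m) * d₀ + 0))
    ≡ 2 * (m * (m + 1)) * dv + (2 * dₘ + (2 * m * dₜ + 0))
kernel-identity m {du} {dw} {dv} {d₀} {dₘ} {dₜ} around-v around-c₀ = begin
  m * (m + 1) * du + (m * (m + 1) * dw + (2 * (1 + m) * d₀ + 0)) ≡⟨ collect m du dw d₀ ⟩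
  m * (m + 1) * (du + dw) + 2 * ((1 + m) * d₀)
    ≡⟨ cong (λ s → m * (m + 1) * s + 2 * ((1 + m) * d₀)) around-v ⟩
  m * (m + 1) * (2 + 2 * dv) + 2 * ((1 + m) * d₀)                ≡⟨ regroup m dv d₀ ⟩
  2 * (m * (m + 1)) * dv + 2 * ((1 + m) * d₀ + m * (m + 1))
    ≡⟨ cong (λ s → 2 * (m * (m + 1)) * dv + 2 * s) around-c₀ ⟩
  2 * (m * (m + 1)) * dv + 2 * (dₘ + m * dₜ)                     ≡⟨ expand m dv dₘ dₜ ⟩
  2 * (m * (m + 1)) * dv + (2 * dₘ + (2 * m * dₜ + 0))           ∎
  where
  open ≡-Reasoning
  collect : ∀ m du dw d₀ → m * (m + 1) * du + (m * (m + 1) * dw + (2 * (1 + m) * d₀ + 0))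
                          ≡ m * (m + 1) * (du + dw) + 2 * ((1 + m) * d₀)
  collect = solve-∀
  regroup : ∀ m dv d₀ → m * (m + 1) * (2 + 2 * dv) + 2 * ((1 + m) * d₀)
                       ≡ 2 * (m * (m + 1)) * dv + 2 * ((1 + m) * d₀ + m * (m + 1))
  regroup = solve-∀
  expand : ∀ m dv dₘ dₜ → 2 * (m * (m + 1)) * dv + 2 * (dₘ + m * dₜ)
                         ≡ 2 * (m * (m + 1)) * dv + (2 * dₘ + (2 * m * dₜ + 0))
  expand = solve-∀

0<2m[m+1] : ∀ {m} → 0 < m → 0 < 2 * (m * (m + 1))
0<2m[m+1] {suc m} _ = s≤s z≤n

mainTheorem10 : ∀ (n : ℕ) (U : SimpleGraph n) → Connected U →
    ∀ (k : ℕ) (c : Fin (suc k) → Fin n) → UniqueCycle U c →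
    2 ∣ suc k →
    (∃ λ i → degree U (c i) ≡ 3 × (∀ j → j ≢ i → degree U (c j) ≡ 2)) →
    (∃ λ v → degree U v ≡ 2 × ¬ OnCycle c v) →
    ZeroIsEigenvalue (DistSq U)
mainTheorem10 n U connected k c unicycle (divides m K≡m*2) (i₀ , deg3 , deg2) (v , deg-v , v-offCycle)
  with offCycle-degree2 connected unicycle deg-v v-offCycle
... | u , w , vu , vw , around-v =
  -- DistSq U i j is definitionally ι (dist² U i j)
  weighted-kernel (dist² U) x⁺ x⁻ (λ z → kernel-identity m (around-v z) (dist²-identity z)) {v}
    (λ x⁺≡x⁻ → <⇒≢ 0<x⁻[v] (trans (sym x⁺[v]≡0) x⁺≡x⁻))
  where
  open CycleGeometry U connected unicycle {m = m} K≡m*2 deg3 deg2 using (d; t; dist²-identity; 0<m)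
  x⁺ = (m * (m + 1) , u) ∷ (m * (m + 1) , w) ∷ (2 * (1 + m) , d 0) ∷ []
  x⁻ = (2 * (m * (m + 1)) , v) ∷ (2 , d m) ∷ (2 * m , t) ∷ []
  x⁺[v]≡0 : weighted x⁺ v ≡ 0
  x⁺[v]≡0 = weighted-∉ x⁺ ((λ u≡v → Adj-irrefl U (subst (Adj U v) u≡v vu))
                         ∷ (λ w≡v → Adj-irrefl U (subst (Adj U v) w≡v vw))
                         ∷ (λ c₀≡v → v-offCycle (i₀ , c₀≡v)) ∷ [])
  0<x⁻[v] : 0 < weighted x⁻ v
  0<x⁻[v] = weighted-head-pos {a = 2 * (m * (m + 1))} {p = v} ((2 , d m) ∷ (2 * m , t) ∷ []) (0<2m[m+1] 0<m)
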